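{- If $T$ is a tree with $\mathrm{msd}_{\gamma_t}(T)=3$, then $T$ has no strong support vertex.
   Context: A support vertex is a vertex adjacent to a leaf; a strong support vertex is a vertex adjacent to at least two leaves. A set $S\subseteq V(G)$ is a total dominating set of $G$ if every vertex of $G$ is adjacent to a vertex of $S$; $\gamma_t(G)$ is the minimum size of such a set. For an edge $e=uv$ and $t\ge1$, $G_{e,t}$ is obtained by replacing $uv$ by a path $(u,x_1,\dots,x_t,v)$ with $t$ new vertices; $\mathrm{msd}_{\gamma_t}(uv)$ is the least positive $t$ with $\gamma_t(G_{uv,t})>\gamma_t(G)$, and $\mathrm{msd}_{\gamma_t}(G)=\min_{uv\in E(G)}\mathrm{msd}_{\gamma_t}(uv)$. -}

module Defs where

open import Data.Nat using (ℕ; zero; suc; _+_; _≤_; _<_)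
open import Data.Fin using (Fin; zero; suc; toℕ; splitAt; inject₁; fromℕ)
open import Data.Fin.Subset using (Subset; _∈_; ∣_∣)
open import Data.Sum using (_⊎_; inj₁; inj₂)
open import Data.Product using (Σ; _×_; ∃; ∃-syntax; _,_)
open import Relation.Nullary using (¬_)
open import Relation.Binary.PropositionalEquality using (_≡_; _≢_)
open import Function.Definitions using (Injective)

record Graph : Set₁ where
  field
    n   : ℕ
    Adj : Fin n → Fin n → Set

open Graph public

IsSimple : Graph → Set
IsSimple G = (∀ u v → Adj G u v → Adj G v u) × (∀ v → ¬ Adj G v v)

data Walk (G : Graph) : Fin (n G) → Fin (n G) → Set where
  [] : ∀ {v} → Walk G v v
  _∷_ : ∀ {u v w} → Adj G u v → Walk G v w → Walk G u w

Connected : Graph → Set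
Connected G = ∀ u v → Walk G u v

Cycle : Graph → Set
Cycle G = Σ ℕ λ k → Σ (Fin (3 + k) → Fin (n G)) λ f →
  Injective _≡_ _≡_ f
  × (∀ (i : Fin (2 + k)) → Adj G (f (inject₁ i)) (f (suc i)))
  × Adj G (f (fromℕ (2 + k))) (f zero)

Acyclic : Graph → Set
Acyclic G = ¬ Cycle G

IsTree : Graph → Set
IsTree G = IsSimple G × Connected G × Acyclic G

IsLeaf : (G : Graph) → Fin (n G) → Set
IsLeaf G v = Σ (Fin (n G)) λ w → Adj G v w × (∀ w' → Adj G v w' → w' ≡ w)

IsStrongSupport : (G : Graph) → Fin (n G) → Set
IsStrongSupport G v = Σ (Fin (n G)) λ l₁ → Σ (Fin (n G)) λ l₂ →
  l₁ ≢ l₂ × Adj G v l₁ × Adj G v l₂ × IsLeaf G l₁ × IsLeaf G l₂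

-- Total dominating sets and the total domination number (as a relation:
-- GammaT G k  means  γ_t(G) = k).
IsTDS : (G : Graph) → Subset (n G) → Set
IsTDS G S = ∀ v → Σ (Fin (n G)) λ w → Adj G v w × w ∈ S

GammaT : Graph → ℕ → Set
GammaT G k = (Σ (Subset (n G)) λ S → IsTDS G S × ∣ S ∣ ≡ k)
           × (∀ S → IsTDS G S → k ≤ ∣ S ∣)

GammaTGreater : Graph → Graph → Set
GammaTGreater H G = Σ ℕ λ a → Σ ℕ λ b → GammaT H a × GammaT G b × b < a

-- Subdivision G_{ab,t}: the edge ab is replaced by the path
-- (a, x₀, …, x_{t-1}, b); the new vertex x_i is  raise n i  in Fin (n + t).
SubAdj : (G : Graph) → Fin (n G) → Fin (n G) → (t : ℕ)
       → Fin (n G + t) → Fin (n G + t) → Set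
SubAdj G a b t x y with splitAt (n G) x | splitAt (n G) y
... | inj₁ u | inj₁ v = Adj G u v × ¬ ((u ≡ a × v ≡ b) ⊎ (u ≡ b × v ≡ a))
... | inj₁ u | inj₂ j = (u ≡ a × toℕ j ≡ 0) ⊎ (u ≡ b × suc (toℕ j) ≡ t)
... | inj₂ i | inj₁ v = (v ≡ a × toℕ i ≡ 0) ⊎ (v ≡ b × suc (toℕ i) ≡ t)
... | inj₂ i | inj₂ j = (suc (toℕ i) ≡ toℕ j) ⊎ (suc (toℕ j) ≡ toℕ i)

Subdivide : (G : Graph) → Fin (n G) → Fin (n G) → ℕ → Graph
Subdivide G a b t = record { n = n G + t ; Adj = SubAdj G a b t }

MsdEdge : (G : Graph) → Fin (n G) → Fin (n G) → ℕ → Set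
MsdEdge G u v m = 1 ≤ m × GammaTGreater (Subdivide G u v m) G
  × (∀ t → 1 ≤ t → t < m → ¬ GammaTGreater (Subdivide G u v t) G)

Msd : Graph → ℕ → Set
Msd G m = (Σ (Fin (n G)) λ u → Σ (Fin (n G)) λ v → Adj G u v × MsdEdge G u v m)
        × (∀ u v → Adj G u v → ∀ m' → MsdEdge G u v m' → m ≤ m')

-- Let s be adjacent to two leaves p and q of a connected graph G, and let H be G with the
-- edge sp subdivided twice, giving the path s x₀ x₁ p.  A total dominating set S' of H must
-- contain x₁ (the only neighbour of p), s (the only neighbour of q) and one of x₀, p (to
-- dominate x₁).  Dropping x₀, x₁ and adding p therefore gives a total dominating set of G
-- with fewer vertices, so γₜ(H) > γₜ(G) and msd(sp) ≤ 2.  Hence msd(G) = 3 rules out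
-- strong support vertices.
module Submission where

open import Defs
open import Data.Fin using (Fin)
open import Relation.Nullary using (¬_)

open import Data.Empty using (⊥-elim)
open import Data.Fin as Fin using (zero; suc; toℕ; inject₁; fromℕ; _↑ˡ_; _↑ʳ_; _≟_)
open import Data.Fin.Properties
  using (splitAt⁻¹-↑ˡ; splitAt⁻¹-↑ʳ; splitAt-↑ˡ; splitAt-↑ʳ; toℕ-inject₁; toℕ-fromℕ)
open import Data.Fin.Subset using (Subset; _∈_; _⊆_; _∪_; ⁅_⁆; ∣_∣; ⊤; inside; outside)
open import Data.Fin.Subset.Properties
  using (∈⊤; x∈p∪q⁺; x∈p∪q⁻; x∈⁅x⁆; x∈⁅y⁆⇒x≡y; ∣⁅x⁆∣≡1; ∣p∣≤∣x∷p∣; p⊆q⇒∣p∣≤∣q∣)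
open import Data.Nat using (ℕ; zero; suc; _+_; _≤_; _<_; z≤n; s≤s; s≤s⁻¹)
open import Data.Nat.Properties
  using ( ≤-refl; ≤-trans; <-≤-trans; ≤-<-trans; ≮⇒≥; n≤1+n; n<1+n; <-irrefl; m<m+n
        ; +-suc; +-monoʳ-≤; +-monoʳ-<; module ≤-Reasoning)
open import Data.Product using (Σ; ∃; _×_; _,_; proj₁; proj₂)
open import Data.Sum using (_⊎_; inj₁; inj₂; [_,_])
open import Data.Vec using ([]; _∷_; _++_; splitAt; here; there)
open import Data.Vec.Properties using ([]=⇒lookup; lookup⇒[]=; lookup-++ˡ; lookup-++ʳ)
open import Function using (_∘_)
open import Relation.Binary.PropositionalEquality using (_≡_; _≢_; refl; sym; trans; cong; subst)
open import Relation.Nullary using (yes; no)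
open import Relation.Nullary.Decidable using (¬¬-excluded-middle)

coerce : {A B : Set} → A ≡ B → A → B
coerce refl a = a

∣p++q∣≡∣p∣+∣q∣ : ∀ {k m} (p : Subset k) (q : Subset m) → ∣ p ++ q ∣ ≡ ∣ p ∣ + ∣ q ∣
∣p++q∣≡∣p∣+∣q∣ []            q = refl
∣p++q∣≡∣p∣+∣q∣ (inside ∷ p)  q = cong suc (∣p++q∣≡∣p∣+∣q∣ p q)
∣p++q∣≡∣p∣+∣q∣ (outside ∷ p) q = ∣p++q∣≡∣p∣+∣q∣ p q

∣p∪q∣≤∣p∣+∣q∣ : ∀ {k} (p q : Subset k) → ∣ p ∪ q ∣ ≤ ∣ p ∣ + ∣ q ∣
∣p∪q∣≤∣p∣+∣q∣ []            []            = z≤n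
∣p∪q∣≤∣p∣+∣q∣ (inside ∷ p)  (outside ∷ q) = s≤s (∣p∪q∣≤∣p∣+∣q∣ p q)
∣p∪q∣≤∣p∣+∣q∣ (inside ∷ p)  (inside ∷ q)  =
  s≤s (≤-trans (∣p∪q∣≤∣p∣+∣q∣ p q) (+-monoʳ-≤ ∣ p ∣ (n≤1+n ∣ q ∣)))
∣p∪q∣≤∣p∣+∣q∣ (outside ∷ p) (outside ∷ q) = ∣p∪q∣≤∣p∣+∣q∣ p q
∣p∪q∣≤∣p∣+∣q∣ (outside ∷ p) (inside ∷ q)  =
  subst (suc ∣ p ∪ q ∣ ≤_) (sym (+-suc ∣ p ∣ ∣ q ∣)) (s≤s (∣p∪q∣≤∣p∣+∣q∣ p q))

∣p∪⁅x⁆∣≤∣p∣+1 : ∀ {k} (p : Subset k) x → ∣ p ∪ ⁅ x ⁆ ∣ ≤ ∣ p ∣ + 1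
∣p∪⁅x⁆∣≤∣p∣+1 p x = subst (λ c → ∣ p ∪ ⁅ x ⁆ ∣ ≤ ∣ p ∣ + c) (∣⁅x⁆∣≡1 x) (∣p∪q∣≤∣p∣+∣q∣ p ⁅ x ⁆)

x∈p⇒p∪⁅x⁆⊆p : ∀ {k} {p : Subset k} {x} → x ∈ p → p ∪ ⁅ x ⁆ ⊆ p
x∈p⇒p∪⁅x⁆⊆p {p = p} {x} x∈p y∈ with x∈p∪q⁻ p ⁅ x ⁆ y∈
... | inj₁ y∈p  = y∈p
... | inj₂ y∈⁅x⁆ = subst (_∈ p) (sym (x∈⁅y⁆⇒x≡y x y∈⁅x⁆)) x∈p

∣p∪⁅x⁆∣<∣p++q∣ : ∀ {k} (p : Subset k) {x} {q : Subset 2} →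
                 suc zero ∈ q → x ∈ p ⊎ zero ∈ q → ∣ p ∪ ⁅ x ⁆ ∣ < ∣ p ++ q ∣
∣p∪⁅x⁆∣<∣p++q∣ p {x} {r ∷ _ ∷ []} (there here) (inj₁ x∈p) = begin-strict
  ∣ p ∪ ⁅ x ⁆ ∣               ≤⟨ p⊆q⇒∣p∣≤∣q∣ (x∈p⇒p∪⁅x⁆⊆p x∈p) ⟩
  ∣ p ∣                      <⟨ m<m+n ∣ p ∣ (∣p∣≤∣x∷p∣ r (inside ∷ [])) ⟩
  ∣ p ∣ + ∣ r ∷ inside ∷ [] ∣ ≡⟨ ∣p++q∣≡∣p∣+∣q∣ p (r ∷ inside ∷ []) ⟨
  ∣ p ++ r ∷ inside ∷ [] ∣   ∎
  where open ≤-Reasoning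
∣p∪⁅x⁆∣<∣p++q∣ p {x} {_ ∷ _ ∷ []} (there here) (inj₂ here) = begin-strict
  ∣ p ∪ ⁅ x ⁆ ∣                  ≤⟨ ∣p∪⁅x⁆∣≤∣p∣+1 p x ⟩
  ∣ p ∣ + 1                     <⟨ +-monoʳ-< ∣ p ∣ (n<1+n 1) ⟩
  ∣ p ∣ + 2                     ≡⟨ ∣p++q∣≡∣p∣+∣q∣ p (inside ∷ inside ∷ []) ⟨
  ∣ p ++ inside ∷ inside ∷ [] ∣ ∎
  where open ≤-Reasoning

↑ˡ∈++⁻ : ∀ {k m} (p : Subset k) (q : Subset m) {u} → u ↑ˡ m ∈ p ++ q → u ∈ p
↑ˡ∈++⁻ p q {u} u∈ = lookup⇒[]= u p (trans (sym (lookup-++ˡ p q u)) ([]=⇒lookup u∈))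

↑ʳ∈++⁻ : ∀ {k m} (p : Subset k) (q : Subset m) {j} → k ↑ʳ j ∈ p ++ q → j ∈ q
↑ʳ∈++⁻ p q {j} j∈ = lookup⇒[]= j q (trans (sym (lookup-++ʳ p q j)) ([]=⇒lookup j∈))

Least : (ℕ → Set) → ℕ → Set
Least P k = P k × (∀ j → j < k → ¬ P j)

¬¬-least : ∀ {P : ℕ → Set} m → P m → ¬ ¬ ∃ (Least P)
¬¬-least {P} m pm noLeast = noneBelow (suc m) m ≤-refl pm
  where
  noneBelow : ∀ k j → j < k → ¬ P j
  noneBelow (suc k) j j<1+k pj =
    noLeast (j , pj , λ i i<j → noneBelow k i (<-≤-trans i<j (s≤s⁻¹ j<1+k)))

HasTDSOfSize : (G : Graph) → ℕ → Set
HasTDSOfSize G k = Σ (Subset (n G)) λ S → IsTDS G S × ∣ S ∣ ≡ k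

-- Adjacency is an arbitrary relation, so γₜ need not be computable; its existence holds
-- under double negation, which suffices for a negative conclusion.
¬¬-gammaT : ∀ G {S} → IsTDS G S → ¬ ¬ ∃ (GammaT G)
¬¬-gammaT G {S} tds noGammaT =
  ¬¬-least {HasTDSOfSize G} ∣ S ∣ (S , tds , refl) λ (k , hasK , noneBelow) →
  noGammaT (k , hasK , λ S' tds' → ≮⇒≥ λ ∣S'∣<k → noneBelow ∣ S' ∣ ∣S'∣<k (S' , tds' , refl))

TDSShrinks : Graph → Graph → Set
TDSShrinks H G = ∀ S' → IsTDS H S' → Σ (Subset (n G)) λ S → IsTDS G S × ∣ S ∣ < ∣ S' ∣

TDSShrinks⇒gammaT< : ∀ {H G a b} → TDSShrinks H G → GammaT H a → GammaT G b → b < a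
TDSShrinks⇒gammaT< shrinks ((S' , tds' , refl) , _) (_ , b≤) with shrinks S' tds'
... | S , tds , ∣S∣<∣S'∣ = ≤-<-trans (b≤ S tds) ∣S∣<∣S'∣

data SplitView (m : ℕ) {k : ℕ} : Fin (m + k) → Set where
  old : (u : Fin m) → SplitView m (u ↑ˡ k)
  new : (j : Fin k) → SplitView m (m ↑ʳ j)

splitView : ∀ m {k} (x : Fin (m + k)) → SplitView m x
splitView m x with Fin.splitAt m x in eq
... | inj₁ u = subst (SplitView m) (splitAt⁻¹-↑ˡ eq) (old u)
... | inj₂ j = subst (SplitView m) (splitAt⁻¹-↑ʳ eq) (new j)

module _ (G : Graph) (a b : Fin (n G)) (t : ℕ) where

  subAdj-old-old : ∀ u w → SubAdj G a b t (u ↑ˡ t) (w ↑ˡ t)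
                         ≡ (Adj G u w × ¬ ((u ≡ a × w ≡ b) ⊎ (u ≡ b × w ≡ a)))
  subAdj-old-old u w rewrite splitAt-↑ˡ (n G) u t | splitAt-↑ˡ (n G) w t = refl

  subAdj-old-new : ∀ u j → SubAdj G a b t (u ↑ˡ t) (n G ↑ʳ j)
                         ≡ ((u ≡ a × toℕ j ≡ 0) ⊎ (u ≡ b × suc (toℕ j) ≡ t))
  subAdj-old-new u j rewrite splitAt-↑ˡ (n G) u t | splitAt-↑ʳ (n G) t j = refl

  subAdj-new-old : ∀ i w → SubAdj G a b t (n G ↑ʳ i) (w ↑ˡ t)
                         ≡ ((w ≡ a × toℕ i ≡ 0) ⊎ (w ≡ b × suc (toℕ i) ≡ t))
  subAdj-new-old i w rewrite splitAt-↑ʳ (n G) t i | splitAt-↑ˡ (n G) w t = refl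

  subAdj-new-new : ∀ i j → SubAdj G a b t (n G ↑ʳ i) (n G ↑ʳ j)
                         ≡ ((suc (toℕ i) ≡ toℕ j) ⊎ (suc (toℕ j) ≡ toℕ i))
  subAdj-new-new i j rewrite splitAt-↑ʳ (n G) t i | splitAt-↑ʳ (n G) t j = refl

connected⇒⊤-isTDS : ∀ {G a b} → Connected G → Adj G a b → IsTDS G ⊤
connected⇒⊤-isTDS {a = a} {b} conn a—b u with conn u a
... | []      = b , a—b , ∈⊤
... | u—w ∷ _ = _ , u—w , ∈⊤

subdivide-⊤-isTDS : ∀ {G} a b t → IsTDS G ⊤ → IsTDS (Subdivide G a b (suc t)) ⊤
subdivide-⊤-isTDS {G} a b t tds x with splitView (n G) x
... | new zero    = a ↑ˡ suc t ,
  coerce (sym (subAdj-new-old G a b (suc t) zero a)) (inj₁ (refl , refl)) , ∈⊤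
... | new (suc j) = n G ↑ʳ inject₁ j ,
  coerce (sym (subAdj-new-new G a b (suc t) (suc j) (inject₁ j))) (inj₂ (cong suc (toℕ-inject₁ j))) , ∈⊤
... | old u with u ≟ a | u ≟ b
...   | yes refl | _        = n G ↑ʳ zero ,
  coerce (sym (subAdj-old-new G a b (suc t) a zero)) (inj₁ (refl , refl)) , ∈⊤
...   | no _     | yes refl = n G ↑ʳ fromℕ t ,
  coerce (sym (subAdj-old-new G a b (suc t) b (fromℕ t))) (inj₂ (refl , cong suc (toℕ-fromℕ t))) , ∈⊤
...   | no u≢a   | no u≢b with tds u
...     | w , u—w , _ = w ↑ˡ suc t ,
  coerce (sym (subAdj-old-old G a b (suc t) u w)) (u—w , [ u≢a ∘ proj₁ , u≢b ∘ proj₁ ]) , ∈⊤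

leaf-neighbour-unique : ∀ G {l u w} → IsLeaf G l → Adj G l u → Adj G l w → u ≡ w
leaf-neighbour-unique _ (_ , _ , onlyNeighbour) l—u l—w =
  trans (onlyNeighbour _ l—u) (sym (onlyNeighbour _ l—w))

module TwoLeaves (G : Graph) (simple : IsSimple G) {s p q : Fin (n G)} (p≢q : p ≢ q)
                 (s—p : Adj G s p) (s—q : Adj G s q) (leaf-p : IsLeaf G p) (leaf-q : IsLeaf G q) where

  H : Graph
  H = Subdivide G s p 2

  x₀ x₁ : Fin (n G + 2)
  x₀ = n G ↑ʳ zero
  x₁ = n G ↑ʳ suc zero

  adj-sym : ∀ {u w} → Adj G u w → Adj G w u
  adj-sym = proj₁ simple _ _

  adj-≢ : ∀ {u w} → Adj G u w → u ≢ w
  adj-≢ {u} u—w refl = proj₂ simple u u—w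

  old-old : ∀ {u w} → Adj H (u ↑ˡ 2) (w ↑ˡ 2) → Adj G u w × ¬ ((u ≡ s × w ≡ p) ⊎ (u ≡ p × w ≡ s))
  old-old = coerce (subAdj-old-old G s p 2 _ _)

  old-new : ∀ {u j} → Adj H (u ↑ˡ 2) (n G ↑ʳ j) → (u ≡ s × toℕ j ≡ 0) ⊎ (u ≡ p × suc (toℕ j) ≡ 2)
  old-new = coerce (subAdj-old-new G s p 2 _ _)

  new-old : ∀ {i w} → Adj H (n G ↑ʳ i) (w ↑ˡ 2) → (w ≡ s × toℕ i ≡ 0) ⊎ (w ≡ p × suc (toℕ i) ≡ 2)
  new-old = coerce (subAdj-new-old G s p 2 _ _)

  new-new : ∀ {i j} → Adj H (n G ↑ʳ i) (n G ↑ʳ j) → (suc (toℕ i) ≡ toℕ j) ⊎ (suc (toℕ j) ≡ toℕ i)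
  new-new = coerce (subAdj-new-new G s p 2 _ _)

  module _ {S' : Subset (n G + 2)} (tds : IsTDS H S') where

    x₁∈ : x₁ ∈ S'
    x₁∈ with tds (p ↑ˡ 2)
    ... | w , p—w , w∈ with splitView (n G) w
    ...   | old u with old-old p—w
    ...     | p—u , notSubdivided =
      ⊥-elim (notSubdivided (inj₂ (refl , leaf-neighbour-unique G leaf-p p—u (adj-sym s—p))))
    x₁∈ | w , p—w , w∈ | new zero with old-new p—w
    ...     | inj₁ (refl , _) = ⊥-elim (adj-≢ s—p refl)
    ...     | inj₂ (_ , ())
    x₁∈ | w , p—w , w∈ | new (suc zero) = w∈

    p∈⊎x₀∈ : p ↑ˡ 2 ∈ S' ⊎ x₀ ∈ S'
    p∈⊎x₀∈ with tds x₁
    ... | w , x₁—w , w∈ with splitView (n G) w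
    ...   | new zero = inj₂ w∈
    ...   | old u with new-old x₁—w
    ...     | inj₂ (refl , _) = inj₁ w∈
    p∈⊎x₀∈ | w , x₁—w , w∈ | new (suc zero) with new-new x₁—w
    ...     | inj₁ ()
    ...     | inj₂ ()

    s∈ : s ↑ˡ 2 ∈ S'
    s∈ with tds (q ↑ˡ 2)
    ... | w , q—w , w∈ with splitView (n G) w
    ...   | old u =
      subst (λ v → v ↑ˡ 2 ∈ S') (leaf-neighbour-unique G leaf-q (proj₁ (old-old q—w)) (adj-sym s—q)) w∈
    ...   | new j with old-new q—w
    ...     | inj₁ (refl , _) = ⊥-elim (adj-≢ s—q refl)
    ...     | inj₂ (refl , _) = ⊥-elim (p≢q refl)

  subdivide-TDSShrinks : TDSShrinks H G
  subdivide-TDSShrinks S' tds with splitAt (n G) S'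
  ... | L , R , refl = L ∪ ⁅ p ⁆ , dominates , ∣p∪⁅x⁆∣<∣p++q∣ L (↑ʳ∈++⁻ L R (x₁∈ tds)) p∈⊎0∈
    where
    p∈⊎0∈ : p ∈ L ⊎ zero ∈ R
    p∈⊎0∈ = [ inj₁ ∘ ↑ˡ∈++⁻ L R , inj₂ ∘ ↑ʳ∈++⁻ L R ] (p∈⊎x₀∈ tds)

    dominates : IsTDS G (L ∪ ⁅ p ⁆)
    dominates y with tds (y ↑ˡ 2)
    ... | w , y—w , w∈ with splitView (n G) w
    ...   | old u = u , proj₁ (old-old y—w) , x∈p∪q⁺ (inj₁ (↑ˡ∈++⁻ L R w∈))
    ...   | new j with old-new y—w
    ...     | inj₁ (refl , _) = p , s—p , x∈p∪q⁺ (inj₂ (x∈⁅x⁆ p))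
    ...     | inj₂ (refl , _) = s , adj-sym s—p , x∈p∪q⁺ (inj₁ (↑ˡ∈++⁻ L R (s∈ tds)))

  msdEdge≤2 : IsTDS G ⊤ → ¬ ¬ ∃ λ m → m ≤ 2 × MsdEdge G s p m
  msdEdge≤2 ⊤-tds noMsd = ¬¬-excluded-middle λ
    { (yes raisedBy1) → noMsd (1 , n≤1+n 1 , ≤-refl , raisedBy1 , λ { (suc _) _ (s≤s ()) })
    ; (no notRaisedBy1) →
        ¬¬-gammaT H (subdivide-⊤-isTDS s p 1 ⊤-tds) λ (a , γₜH) →
        ¬¬-gammaT G ⊤-tds λ (b , γₜG) →
        noMsd ( 2 , ≤-refl , n≤1+n 1
              , (a , b , γₜH , γₜG , TDSShrinks⇒gammaT< subdivide-TDSShrinks γₜH γₜG)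
              , λ { 1 _ _ → notRaisedBy1 ; (suc (suc _)) _ (s≤s (s≤s ())) }) }

mainTheorem10 : (T : Graph) → IsTree T → Msd T 3 → ∀ (v : Fin (n T)) → ¬ IsStrongSupport T v
mainTheorem10 T (simple , connected , _) (_ , msd-least) s (p , q , p≢q , s—p , s—q , leaf-p , leaf-q) =
  msdEdge≤2 (connected⇒⊤-isTDS connected s—p) λ (m , m≤2 , msdEdge-sp) →
    <-irrefl refl (≤-trans (msd-least s p s—p m msdEdge-sp) m≤2)
  where open TwoLeaves T simple p≢q s—p s—q leaf-p leaf-q
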